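{- Let $\mathcal{M}$ be an $n$-maniplex, let $\mathcal{C}$ be an $\ell$-colouring of the facets of $\mathcal{M}$, and let $\omega\colon E(\mathcal{M})\to\mathbb{Z}_k$. If $\mathcal{M}^\omega$ has the string property, then $(2^{(\mathcal{M},\mathcal{C})})^{\omega_\mathcal{C}}$ has the string property.
   Context: An $n$-maniplex is a connected $n$-valent simple graph with a proper edge-colouring by $\{0,\dots,n-1\}$ satisfying the string property: whenever $|i-j|>1$ the edges of colours $i,j$ form a disjoint union of $4$-cycles. Vertices are flags; $u^i$ is the $i$-neighbour of $u$. Facets are the connected components after deleting the edges of colour $n-1$. An $\ell$-colouring is a surjection $\mathcal{C}$ from facets to $\{1,\dots,\ell\}$; a flag's colour is its facet's colour. The colour-coded extension $2^{(\mathcal{M},\mathcal{C})}$ is the $(n+1)$-maniplex with flag set $\mathcal{F}\times\mathbb{Z}_2^\ell$ ($\mathcal{F}$ the flags of $\mathcal{M}$), with $(u,x)^i=(u^i,x)$ for $i<n$ and $(u,x)^n=(u,x^j)$ where $j$ is the colour of $u$ and $x^j$ differs from $x$ only in coordinate $j$. The parity $\sigma(x)$ of $x\in\mathbb{Z}_2^\ell$ is $(-1)^{b}$ with $b$ the number of coordinates equal to $1$. The extended weight $\omega_\mathcal{C}\colon E(2^{(\mathcal{M},\mathcal{C})})\to\mathbb{Z}_k$ assigns to the $i$-edge joining $(u,x)$ and $(u^i,x)$ ($i<n$) the value $\sigma(x)\omega(uu^i)$, and $0$ to every edge of colour $n$. For a graph $\Gamma$ with weight $\omega\colon E(\Gamma)\to\mathbb{Z}_k$,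 the cross-cover $\Gamma^\omega$ has vertex set $V(\Gamma)\times\mathbb{Z}_k$ with $(u,i)$ adjacent to $(v,\omega(e)-i)$ for each edge $e=uv$ and $i\in\mathbb{Z}_k$, the new edge getting the colour of $e$; "string property" for such a coloured graph means the condition above. -}

module Defs where

open import Data.Nat using (ℕ; zero; suc; _+_; _∸_; _<_; _%_; _≡ᵇ_; ∣_-_∣; NonZero)
open import Data.Nat.DivMod using (_mod_)
open import Data.Fin using (Fin; toℕ)
open import Data.Bool using (Bool; if_then_else_; not)
open import Data.Vec using (Vec; updateAt; countᵇ)
open import Data.Maybe using (Maybe; just; nothing)
import Data.Maybe as Maybe
open import Data.Product using (_×_; _,_; ∃)
open import Function using () renaming (id to idf)
open import Relation.Binary.PropositionalEquality using (_≡_; _≢_)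
open import Relation.Binary.Construct.Closure.ReflexiveTransitive using (Star)

Zk : ℕ → Set
Zk k = Fin k

module _ {k : ℕ} .{{_ : NonZero k}} where
  infixl 6 _⊕_ _⊖_
  _⊕_ : Zk k → Zk k → Zk k
  a ⊕ b = (toℕ a + toℕ b) mod k

  ⊝_ : Zk k → Zk k
  ⊝ a = (k ∸ toℕ a) mod k

  _⊖_ : Zk k → Zk k → Zk k
  a ⊖ b = a ⊕ (⊝ b)

  0ₖ : Zk k
  0ₖ = 0 mod k

-- Edge-coloured graphs in which every vertex has exactly one edge of
-- each colour i : Fin m are given by the i-neighbour maps r i : V → V
-- (involutions).

FarApart : ∀ {m} → Fin m → Fin m → Set
FarApart i j = 1 < ∣ toℕ i - toℕ j ∣

-- String property: for |i-j|>1, the connected component of every vertex v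
-- in the subgraph of colours i,j is a 4-cycle
--   v , v^i , v^{ij} , v^{iji} (= v^j) , back to v,
-- i.e. the alternating walk closes after 4 steps and its 4 vertices are
-- pairwise distinct.
StringProp : ∀ {V : Set} {m} → (Fin m → V → V) → Set
StringProp {V} {m} r =
  ∀ (i j : Fin m) → FarApart i j → ∀ (v : V) →
    let v₁ = r i v ; v₂ = r j v₁ ; v₃ = r i v₂ in
    (r j v₃ ≡ v)
    × (v ≢ v₁) × (v ≢ v₂) × (v ≢ v₃) × (v₁ ≢ v₂) × (v₁ ≢ v₃) × (v₂ ≢ v₃)

Adj : ∀ {V : Set} {m} → (Fin m → V → V) → V → V → Set
Adj {m = m} r u v = ∃ λ (i : Fin m) → r i u ≡ v

record Maniplex (n : ℕ) : Set₁ where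
  field
    Flag      : Set
    r         : Fin n → Flag → Flag
    invol     : ∀ i u → r i (r i u) ≡ u       -- the i-edge at u^i is the i-edge at u
    noLoop    : ∀ i u → r i u ≢ u
    noMulti   : ∀ i j u → i ≢ j → r i u ≢ r j u
    connected : ∀ u v → Star (Adj r) u v
    string    : StringProp r

  -- u and v lie in the same facet: connected by a path avoiding colour n-1
  FacetStep : Flag → Flag → Set
  FacetStep u v = ∃ λ (i : Fin n) → (suc (toℕ i) < n) × (r i u ≡ v)

  SameFacet : Flag → Flag → Set
  SameFacet = Star FacetStep

open Maniplex public

-- An ℓ-colouring of the facets (colours {1..ℓ} relabelled as Fin ℓ):
-- a map on flags that is constant on facets (= a map on facets), surjective.
record Colouring {n} (M : Maniplex n) (ℓ : ℕ) : Set where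
  field
    col      : Flag M → Fin ℓ
    onFacets : ∀ u v → SameFacet M u v → col u ≡ col v
    surj     : ∀ (j : Fin ℓ) → ∃ λ u → col u ≡ j

open Colouring public

-- A weight ω : E(M) → Z_k; the edge of colour i at u is {u , u^i}.
record Weight {n} (M : Maniplex n) (k : ℕ) : Set where
  field
    w   : Flag M → Fin n → Zk k
    sym : ∀ u i → w (r M i u) i ≡ w u i

open Weight public

cross : ∀ {V : Set} {m k} .{{_ : NonZero k}} →
        (Fin m → V → V) → (V → Fin m → Zk k) → Fin m → V × Zk k → V × Zk k
cross r ω i (v , a) = r i v , (ω v i ⊖ a)

split : ∀ {n} → Fin (suc n) → Maybe (Fin n)
split {zero}  Fin.zero    = nothing
split {suc n} Fin.zero    = just Fin.zero
split {suc n} (Fin.suc i) = Maybe.map Fin.suc (split i)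

Z2^ : ℕ → Set
Z2^ ℓ = Vec Bool ℓ

flip : ∀ {ℓ} → Fin ℓ → Z2^ ℓ → Z2^ ℓ
flip j x = updateAt x j not

-- σ(x) = -1 iff x has an odd number of coordinates equal to 1
oddParity : ∀ {ℓ} → Z2^ ℓ → Bool
oddParity x = not ((countᵇ idf x % 2) ≡ᵇ 0)

extR : ∀ {n ℓ} (M : Maniplex n) → Colouring M ℓ →
       Fin (suc n) → Flag M × Z2^ ℓ → Flag M × Z2^ ℓ
extR M C i (u , x) with split i
... | just i' = r M i' u , x
... | nothing = u , flip (col C u) x

extW : ∀ {n ℓ k} .{{_ : NonZero k}} (M : Maniplex n) (C : Colouring M ℓ) →
       Weight M k → Flag M × Z2^ ℓ → Fin (suc n) → Zk k
extW M C ω (u , x) i with split i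
... | just i' = if oddParity x then ⊝ (w ω u i') else w ω u i'
... | nothing = 0ₖ

{-# OPTIONS --safe #-}
-- Fix colours i, j with |i - j| > 1.  If both are old colours, then for fixed x
-- the sheet {((u , x) , a)} is a copy of M^ω under (u , a) ↦ ((u , x) , σ(x) a),
-- so the 4-cycles of M^ω carry over.  If j = n is the new colour, then i ≤ n - 2
-- keeps u in its facet and hence keeps its colour, so the two involutions
-- commute: the sign σ changes exactly when the n-edge flips a coordinate of x.
-- Two commuting fixed-point-free involutions span a 4-cycle at every vertex
-- their composite moves, and the composite moves the flag u.
module Submission where

open import Defs hiding (sym)
open import Algebra.Bundles using (AbelianGroup)
open import Algebra.Consequences.Propositional using (comm∧idˡ⇒id; comm∧invʳ⇒inv)
open import Algebra.Definitions using (Involutive)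
import Algebra.Properties.AbelianGroup as AbelianGroupProperties
open import Algebra.Structures using (IsAbelianGroup)
open import Data.Bool using (true; false; not; if_then_else_)
open import Data.Bool.Properties using (not-involutive; not-¬)
open import Data.Empty using (⊥-elim)
open import Data.Fin using (Fin; zero; suc; toℕ; inject₁; fromℕ)
open import Data.Fin.Properties using (toℕ-injective; toℕ-fromℕ<; toℕ<n; toℕ-inject₁; toℕ-fromℕ)
open import Data.Fin.Relation.Unary.Top using (view; ‵fromℕ; ‵inject₁)
open import Data.Maybe using (just; nothing)
open import Data.Nat as ℕ using (ℕ; _+_; _∸_; _%_; _≡ᵇ_; _<_; ∣_-_∣; NonZero)
open import Data.Nat.DivMod using (_mod_; %-distribˡ-+; m%n%n≡m%n; m<n⇒m%n≡m; [m+n]%n≡m%n)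
open import Data.Nat.Properties
  using (+-comm; +-assoc; m+[n∸m]≡n; <⇒≤; ∣-∣-comm; ∣n-n∣≡0; m≤n⇒∣m-n∣≡n∸m; m≤o∸n⇒m+n≤o; module ≤-Reasoning)
open import Data.Product using (_×_; _,_; proj₁; proj₂)
open import Data.Vec using (_∷_; lookup; countᵇ)
open import Data.Vec.Properties using (updateAt-updateAt-local; updateAt-id; lookup∘updateAt)
open import Function using (_∘_; id)
open import Level using (0ℓ)
open import Relation.Binary.PropositionalEquality
open import Relation.Binary.Construct.Closure.ReflexiveTransitive using (ε; _◅_)
open import Relation.Nullary using (¬_)

[m%n+o]%n≡[m+o]%n : ∀ m n o .{{_ : NonZero n}} → (m % n + o) % n ≡ (m + o) % n
[m%n+o]%n≡[m+o]%n m n o = begin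
  (m % n + o) % n          ≡⟨ %-distribˡ-+ (m % n) o n ⟩
  (m % n % n + o % n) % n  ≡⟨ cong (λ x → (x + o % n) % n) (m%n%n≡m%n m n) ⟩
  (m % n + o % n) % n      ≡⟨ %-distribˡ-+ m o n ⟨
  (m + o) % n              ∎
  where open ≡-Reasoning

[m+o%n]%n≡[m+o]%n : ∀ m n o .{{_ : NonZero n}} → (m + o % n) % n ≡ (m + o) % n
[m+o%n]%n≡[m+o]%n m n o = begin
  (m + o % n) % n  ≡⟨ cong (_% n) (+-comm m (o % n)) ⟩
  (o % n + m) % n  ≡⟨ [m%n+o]%n≡[m+o]%n o n m ⟩
  (o + m) % n      ≡⟨ cong (_% n) (+-comm o m) ⟩
  (m + o) % n      ∎
  where open ≡-Reasoning

module _ {k : ℕ} .{{_ : NonZero k}} where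
  open ≡-Reasoning

  toℕ-mod : ∀ m → toℕ (m mod k) ≡ m % k
  toℕ-mod m = toℕ-fromℕ< _

  ⊕-assoc : ∀ (a b c : Zk k) → (a ⊕ b) ⊕ c ≡ a ⊕ (b ⊕ c)
  ⊕-assoc a b c = toℕ-injective (begin
    toℕ ((a ⊕ b) ⊕ c)                     ≡⟨ toℕ-mod _ ⟩
    (toℕ (a ⊕ b) + toℕ c) % k             ≡⟨ cong (λ x → (x + toℕ c) % k) (toℕ-mod _) ⟩
    ((toℕ a + toℕ b) % k + toℕ c) % k     ≡⟨ [m%n+o]%n≡[m+o]%n (toℕ a + toℕ b) k (toℕ c) ⟩
    (toℕ a + toℕ b + toℕ c) % k           ≡⟨ cong (_% k) (+-assoc (toℕ a) (toℕ b) (toℕ c)) ⟩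
    (toℕ a + (toℕ b + toℕ c)) % k         ≡⟨ [m+o%n]%n≡[m+o]%n (toℕ a) k (toℕ b + toℕ c) ⟨
    (toℕ a + (toℕ b + toℕ c) % k) % k     ≡⟨ cong (λ x → (toℕ a + x) % k) (toℕ-mod _) ⟨
    (toℕ a + toℕ (b ⊕ c)) % k             ≡⟨ toℕ-mod _ ⟨
    toℕ (a ⊕ (b ⊕ c))                     ∎)

  ⊕-comm : ∀ (a b : Zk k) → a ⊕ b ≡ b ⊕ a
  ⊕-comm a b = cong (_mod k) (+-comm (toℕ a) (toℕ b))

  ⊕-identityˡ : ∀ (a : Zk k) → 0ₖ ⊕ a ≡ a
  ⊕-identityˡ a = toℕ-injective (begin
    toℕ (0ₖ ⊕ a)                   ≡⟨ toℕ-mod _ ⟩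
    (toℕ (0 mod k) + toℕ a) % k    ≡⟨ cong (λ x → (x + toℕ a) % k) (toℕ-mod 0) ⟩
    (0 % k + toℕ a) % k            ≡⟨ [m%n+o]%n≡[m+o]%n 0 k (toℕ a) ⟩
    toℕ a % k                      ≡⟨ m<n⇒m%n≡m (toℕ<n a) ⟩
    toℕ a                          ∎)

  ⊕-inverseʳ : ∀ (a : Zk k) → a ⊕ ⊝ a ≡ 0ₖ
  ⊕-inverseʳ a = toℕ-injective (begin
    toℕ (a ⊕ ⊝ a)                          ≡⟨ toℕ-mod _ ⟩
    (toℕ a + toℕ ((k ∸ toℕ a) mod k)) % k  ≡⟨ cong (λ x → (toℕ a + x) % k) (toℕ-mod _) ⟩
    (toℕ a + (k ∸ toℕ a) % k) % k          ≡⟨ [m+o%n]%n≡[m+o]%n (toℕ a) k (k ∸ toℕ a) ⟩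
    (toℕ a + (k ∸ toℕ a)) % k              ≡⟨ cong (_% k) (m+[n∸m]≡n (<⇒≤ (toℕ<n a))) ⟩
    k % k                                  ≡⟨ [m+n]%n≡m%n 0 k ⟩
    0 % k                                  ≡⟨ toℕ-mod 0 ⟨
    toℕ 0ₖ                                 ∎)

  Zk-isAbelianGroup : IsAbelianGroup _≡_ _⊕_ 0ₖ ⊝_
  Zk-isAbelianGroup = record
    { isGroup = record
      { isMonoid = record
        { isSemigroup = record
          { isMagma = record { isEquivalence = isEquivalence ; ∙-cong = cong₂ _⊕_ }
          ; assoc = ⊕-assoc
          }
        ; identity = comm∧idˡ⇒id ⊕-comm ⊕-identityˡ
        }
      ; inverse = comm∧invʳ⇒inv ⊕-comm ⊕-inverseʳ
      ; ⁻¹-cong = cong ⊝_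
      }
    ; comm = ⊕-comm
    }

  Zk-abelianGroup : AbelianGroup 0ℓ 0ℓ
  Zk-abelianGroup = record { isAbelianGroup = Zk-isAbelianGroup }

  open AbelianGroupProperties Zk-abelianGroup
    using (⁻¹-involutive; ⁻¹-∙-comm; ⁻¹-anti-homo-//; //-rightDividesˡ)

  ⊝-involutive : ∀ (a : Zk k) → ⊝ ⊝ a ≡ a
  ⊝-involutive = ⁻¹-involutive

  ⊝-⊖-⊝ : ∀ (a b : Zk k) → ⊝ a ⊖ ⊝ b ≡ ⊝ (a ⊖ b)
  ⊝-⊖-⊝ a b = ⁻¹-∙-comm a (⊝ b)

  ⊖-involutive : ∀ (a b : Zk k) → a ⊖ (a ⊖ b) ≡ b
  ⊖-involutive a b = begin
    a ⊖ (a ⊖ b)  ≡⟨ cong (a ⊕_) (⁻¹-anti-homo-// a b) ⟩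
    a ⊕ (b ⊖ a)  ≡⟨ ⊕-comm a (b ⊖ a) ⟩
    (b ⊖ a) ⊕ a  ≡⟨ //-rightDividesˡ a b ⟩
    b            ∎

-- StringProp r unfolds to ∀ i j → FarApart i j → ∀ v → FourCycle (r i) (r j) v.
FourCycle : {V : Set} → (V → V) → (V → V) → V → Set
FourCycle f g v =
  let v₁ = f v ; v₂ = g v₁ ; v₃ = f v₂ in
  (g v₃ ≡ v) × (v ≢ v₁) × (v ≢ v₂) × (v ≢ v₃) × (v₁ ≢ v₂) × (v₁ ≢ v₃) × (v₂ ≢ v₃)

FourCycle-map : ∀ {V W : Set} {f g : V → V} {f′ g′ : W → W} (φ : V → W) →
  (∀ {v v′} → φ v ≡ φ v′ → v ≡ v′) →
  (∀ v → f′ (φ v) ≡ φ (f v)) → (∀ v → g′ (φ v) ≡ φ (g v)) →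
  ∀ {v} → FourCycle f g v → FourCycle f′ g′ (φ v)
FourCycle-map {f = f} {g} φ φ-injective f-φ g-φ {v} (closes , n₀₁ , n₀₂ , n₀₃ , n₁₂ , n₁₃ , n₂₃)
  rewrite f-φ v | g-φ (f v) | f-φ (g (f v)) | g-φ (f (g (f v))) =
  cong φ closes , n₀₁ ∘ φ-injective , n₀₂ ∘ φ-injective , n₀₃ ∘ φ-injective ,
  n₁₂ ∘ φ-injective , n₁₃ ∘ φ-injective , n₂₃ ∘ φ-injective

FourCycle-commuting : ∀ {V : Set} {f g : V → V} →
  Involutive _≡_ f → Involutive _≡_ g → f ∘ g ≗ g ∘ f →
  (∀ v → f v ≢ v) → (∀ v → g v ≢ v) → ∀ {v} → g (f v) ≢ v → FourCycle f g v
FourCycle-commuting {f = f} {g} f-inv g-inv fg≗gf f-free g-free {v} gfv≢v =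
  closes , f-free v ∘ sym , gfv≢v ∘ sym , (λ e → g-free v (sym (trans e fgfv≡gv))) ,
  g-free (f v) ∘ sym , (λ e → gfv≢v (sym (f-injective e))) , f-free (g (f v)) ∘ sym
  where
    fgfv≡gv : f (g (f v)) ≡ g v
    fgfv≡gv = trans (fg≗gf (f v)) (cong g (f-inv v))
    closes : g (f (g (f v))) ≡ v
    closes = trans (cong g fgfv≡gv) (g-inv v)
    f-injective : ∀ {u u′} → f u ≡ f u′ → u ≡ u′
    f-injective {u} {u′} e = trans (sym (f-inv u)) (trans (cong f e) (f-inv u′))

module _ {V : Set} {m k : ℕ} .{{_ : NonZero k}} {r : Fin m → V → V} {ω : V → Fin m → Zk k} where

  cross-involutive : ∀ i → Involutive _≡_ (r i) → (∀ v → ω (r i v) i ≡ ω v i) →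
    Involutive _≡_ (cross r ω i)
  cross-involutive i r-inv ω-sym (v , a) =
    cong₂ _,_ (r-inv v) (trans (cong (_⊖ (ω v i ⊖ a)) (ω-sym v)) (⊖-involutive (ω v i) a))

  cross-fixedPointFree : ∀ i → (∀ v → r i v ≢ v) → ∀ p → cross r ω i p ≢ p
  cross-fixedPointFree i r-free (v , a) = r-free v ∘ cong proj₁

FarApart-sym : ∀ {m} (i j : Fin m) → FarApart i j → FarApart j i
FarApart-sym i j = subst (1 <_) (∣-∣-comm (toℕ i) (toℕ j))

FarApart-irrefl : ∀ {m} (i : Fin m) → ¬ FarApart i i
FarApart-irrefl i far with () ← subst (1 <_) (∣n-n∣≡0 (toℕ i)) far

FarApart-inject₁ : ∀ {n} (i j : Fin n) → FarApart (inject₁ i) (inject₁ j) → FarApart i j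
FarApart-inject₁ i j = subst₂ (λ a b → 1 < ∣ a - b ∣) (toℕ-inject₁ i) (toℕ-inject₁ j)

FarApart-fromℕ : ∀ {n} (i : Fin n) → FarApart (inject₁ i) (fromℕ n) → ℕ.suc (toℕ i) < n
FarApart-fromℕ {n} i far = m≤o∸n⇒m+n≤o 2 (<⇒≤ (toℕ<n i)) (begin-strict
  1                                    <⟨ far ⟩
  ∣ toℕ (inject₁ i) - toℕ (fromℕ n) ∣  ≡⟨ cong₂ ∣_-_∣ (toℕ-inject₁ i) (toℕ-fromℕ n) ⟩
  ∣ toℕ i - n ∣                        ≡⟨ m≤n⇒∣m-n∣≡n∸m (<⇒≤ (toℕ<n i)) ⟩
  n ∸ toℕ i                            ∎)
  where open ≤-Reasoning

flip-involutive : ∀ {ℓ} (j : Fin ℓ) → Involutive _≡_ (flip j)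
flip-involutive j x =
  trans (updateAt-updateAt-local j x (not-involutive (lookup x j))) (updateAt-id j x)

flip-fixedPointFree : ∀ {ℓ} (j : Fin ℓ) x → flip j x ≢ x
flip-fixedPointFree j x e =
  not-¬ refl (trans (cong (λ y → lookup y j) (sym e)) (lookup∘updateAt j x))

[1+n]%2≡ᵇ0 : ∀ n → (ℕ.suc n % 2 ≡ᵇ 0) ≡ not (n % 2 ≡ᵇ 0)
[1+n]%2≡ᵇ0 ℕ.zero = refl
[1+n]%2≡ᵇ0 (ℕ.suc ℕ.zero) = refl
[1+n]%2≡ᵇ0 (ℕ.suc (ℕ.suc n)) = [1+n]%2≡ᵇ0 n

oddParity-true∷ : ∀ {ℓ} (x : Z2^ ℓ) → oddParity (true ∷ x) ≡ not (oddParity x)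
oddParity-true∷ x = cong not ([1+n]%2≡ᵇ0 (countᵇ id x))

oddParity-flip : ∀ {ℓ} (j : Fin ℓ) x → oddParity (flip j x) ≡ not (oddParity x)
oddParity-flip zero    (true ∷ x)  = sym (trans (cong not (oddParity-true∷ x)) (not-involutive _))
oddParity-flip zero    (false ∷ x) = oddParity-true∷ x
oddParity-flip (suc j) (true ∷ x)  = begin
  oddParity (true ∷ flip j x)  ≡⟨ oddParity-true∷ (flip j x) ⟩
  not (oddParity (flip j x))   ≡⟨ cong not (oddParity-flip j x) ⟩
  not (not (oddParity x))      ≡⟨ cong not (oddParity-true∷ x) ⟨
  not (oddParity (true ∷ x))   ∎
  where open ≡-Reasoning
oddParity-flip (suc j) (false ∷ x) = oddParity-flip j x

module _ {k : ℕ} .{{_ : NonZero k}} {ℓ : ℕ} where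

  signed : Z2^ ℓ → Zk k → Zk k
  signed x a = if oddParity x then ⊝ a else a

  signed-involutive : ∀ x → Involutive _≡_ (signed x)
  signed-involutive x a with oddParity x
  ... | true  = ⊝-involutive a
  ... | false = refl

  signed-⊖ : ∀ x a b → signed x a ⊖ signed x b ≡ signed x (a ⊖ b)
  signed-⊖ x a b with oddParity x
  ... | true  = ⊝-⊖-⊝ a b
  ... | false = refl

  signed-flip : ∀ j x a → signed (flip j x) a ≡ ⊝ signed x a
  signed-flip j x a rewrite oddParity-flip j x with oddParity x
  ... | true  = sym (⊝-involutive a)
  ... | false = refl

split-inject₁ : ∀ {n} (i : Fin n) → split (inject₁ i) ≡ just i
split-inject₁ {ℕ.suc n} zero = refl
split-inject₁ {ℕ.suc n} (suc i) rewrite split-inject₁ i = refl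

split-fromℕ : ∀ n → split (fromℕ n) ≡ nothing
split-fromℕ ℕ.zero = refl
split-fromℕ (ℕ.suc n) rewrite split-fromℕ n = refl

module Extension {n ℓ k : ℕ} .{{_ : NonZero k}}
  (M : Maniplex n) (C : Colouring M ℓ) (ω : Weight M k) where

  cover : Fin (ℕ.suc n) → (Flag M × Z2^ ℓ) × Zk k → (Flag M × Z2^ ℓ) × Zk k
  cover = cross (extR M C) (extW M C ω)

  col-r≡col : ∀ {i} → ℕ.suc (toℕ i) < n → ∀ u → col C (r M i u) ≡ col C u
  col-r≡col {i} inFacet u = sym (onFacets C u (r M i u) ((i , inFacet , refl) ◅ ε))

  extR-involutive : ∀ c → Involutive _≡_ (extR M C c)
  extR-involutive c (u , x) with split c
  ... | just i  = cong (_, x) (invol M i u)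
  ... | nothing = cong (u ,_) (flip-involutive (col C u) x)

  extR-fixedPointFree : ∀ c p → extR M C c p ≢ p
  extR-fixedPointFree c (u , x) with split c
  ... | just i  = noLoop M i u ∘ cong proj₁
  ... | nothing = flip-fixedPointFree (col C u) x ∘ cong proj₂

  extW-sym : ∀ c p → extW M C ω (extR M C c p) c ≡ extW M C ω p c
  extW-sym c (u , x) with split c
  ... | just i  = cong (signed x) (Weight.sym ω u i)
  ... | nothing = refl

  cover-involutive : ∀ c → Involutive _≡_ (cover c)
  cover-involutive c =
    cross-involutive {r = extR M C} {ω = extW M C ω} c (extR-involutive c) (extW-sym c)

  cover-fixedPointFree : ∀ c p → cover c p ≢ p
  cover-fixedPointFree c =
    cross-fixedPointFree {r = extR M C} {ω = extW M C ω} c (extR-fixedPointFree c)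

  cover-inject₁ : ∀ i u x a →
    cover (inject₁ i) ((u , x) , a) ≡ ((r M i u , x) , signed x (w ω u i) ⊖ a)
  cover-inject₁ i u x a rewrite split-inject₁ i = refl

  cover-fromℕ : ∀ u x a → cover (fromℕ n) ((u , x) , a) ≡ ((u , flip (col C u) x) , ⊝ a)
  cover-fromℕ u x a rewrite split-fromℕ n = cong (_ ,_) (⊕-identityˡ (⊝ a))

  sheet : Z2^ ℓ → Flag M × Zk k → (Flag M × Z2^ ℓ) × Zk k
  sheet x (u , a) = ((u , x) , signed x a)

  sheet-injective : ∀ x {p q} → sheet x p ≡ sheet x q → p ≡ q
  sheet-injective x {u , a} {v , b} e = cong₂ _,_ (cong (proj₁ ∘ proj₁) e) (begin
    a                      ≡⟨ signed-involutive x a ⟨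
    signed x (signed x a)  ≡⟨ cong (signed x ∘ proj₂) e ⟩
    signed x (signed x b)  ≡⟨ signed-involutive x b ⟩
    b                      ∎)
    where open ≡-Reasoning

  cover-sheet : ∀ i x p → cover (inject₁ i) (sheet x p) ≡ sheet x (cross (r M) (w ω) i p)
  cover-sheet i x (u , a) =
    trans (cover-inject₁ i u x (signed x a)) (cong ((r M i u , x) ,_) (signed-⊖ x (w ω u i) a))

  FourCycle-inject₁-inject₁ : StringProp (cross (r M) (w ω)) → ∀ i j → FarApart i j →
    ∀ p → FourCycle (cover (inject₁ i)) (cover (inject₁ j)) p
  FourCycle-inject₁-inject₁ string i j far ((u , x) , a) =
    subst (FourCycle (cover (inject₁ i)) (cover (inject₁ j)))
      (cong ((u , x) ,_) (signed-involutive x a))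
      (FourCycle-map {f′ = cover (inject₁ i)} {g′ = cover (inject₁ j)}
        (sheet x) (sheet-injective x) (cover-sheet i x) (cover-sheet j x)
        (string i j far (u , signed x a)))

  cover-inject₁∘cover-fromℕ : ∀ i u x a →
    cover (inject₁ i) (cover (fromℕ n) ((u , x) , a)) ≡
    ((r M i u , flip (col C u) x) , ⊝ (signed x (w ω u i) ⊖ a))
  cover-inject₁∘cover-fromℕ i u x a = begin
    cover (inject₁ i) (cover (fromℕ n) ((u , x) , a))
      ≡⟨ cong (cover (inject₁ i)) (cover-fromℕ u x a) ⟩
    cover (inject₁ i) ((u , x′) , ⊝ a)
      ≡⟨ cover-inject₁ i u x′ (⊝ a) ⟩
    ((r M i u , x′) , signed x′ (w ω u i) ⊖ ⊝ a)
      ≡⟨ cong (λ b → (r M i u , x′) , b ⊖ ⊝ a) (signed-flip (col C u) x (w ω u i)) ⟩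
    ((r M i u , x′) , ⊝ signed x (w ω u i) ⊖ ⊝ a)
      ≡⟨ cong ((r M i u , x′) ,_) (⊝-⊖-⊝ (signed x (w ω u i)) a) ⟩
    ((r M i u , x′) , ⊝ (signed x (w ω u i) ⊖ a)) ∎
    where
      open ≡-Reasoning
      x′ : Z2^ ℓ
      x′ = flip (col C u) x

  cover-fromℕ∘cover-inject₁ : ∀ i u x a →
    cover (fromℕ n) (cover (inject₁ i) ((u , x) , a)) ≡
    ((r M i u , flip (col C (r M i u)) x) , ⊝ (signed x (w ω u i) ⊖ a))
  cover-fromℕ∘cover-inject₁ i u x a =
    trans (cong (cover (fromℕ n)) (cover-inject₁ i u x a))
      (cover-fromℕ (r M i u) x (signed x (w ω u i) ⊖ a))

  cover-inject₁-fromℕ-commute : ∀ {i} → ℕ.suc (toℕ i) < n →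
    cover (inject₁ i) ∘ cover (fromℕ n) ≗ cover (fromℕ n) ∘ cover (inject₁ i)
  cover-inject₁-fromℕ-commute {i} inFacet ((u , x) , a) =
    trans (cover-inject₁∘cover-fromℕ i u x a)
      (trans (cong (λ c → (r M i u , flip c x) , _) (sym (col-r≡col inFacet u)))
        (sym (cover-fromℕ∘cover-inject₁ i u x a)))

  cover-fromℕ∘cover-inject₁-moves : ∀ i p → cover (fromℕ n) (cover (inject₁ i) p) ≢ p
  cover-fromℕ∘cover-inject₁-moves i ((u , x) , a) =
    noLoop M i u ∘ cong (proj₁ ∘ proj₁) ∘ trans (sym (cover-fromℕ∘cover-inject₁ i u x a))

  FourCycle-inject₁-fromℕ : ∀ i → ℕ.suc (toℕ i) < n →
    ∀ p → FourCycle (cover (inject₁ i)) (cover (fromℕ n)) p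
  FourCycle-inject₁-fromℕ i inFacet p =
    FourCycle-commuting (cover-involutive _) (cover-involutive _)
      (cover-inject₁-fromℕ-commute inFacet)
      (cover-fixedPointFree _) (cover-fixedPointFree _)
      (cover-fromℕ∘cover-inject₁-moves i p)

  FourCycle-fromℕ-inject₁ : ∀ i → ℕ.suc (toℕ i) < n →
    ∀ p → FourCycle (cover (fromℕ n)) (cover (inject₁ i)) p
  FourCycle-fromℕ-inject₁ i inFacet p =
    FourCycle-commuting (cover-involutive _) (cover-involutive _)
      (sym ∘ cover-inject₁-fromℕ-commute inFacet)
      (cover-fixedPointFree _) (cover-fixedPointFree _)
      (cover-fromℕ∘cover-inject₁-moves i p ∘ trans (sym (cover-inject₁-fromℕ-commute inFacet p)))

lemma5p1 : ∀ {n ℓ k : ℕ} .{{_ : NonZero k}}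
    (M : Maniplex n) (C : Colouring M ℓ) (ω : Weight M k) →
    StringProp (cross (r M) (w ω)) →
    StringProp (cross (extR M C) (extW M C ω))
lemma5p1 {n} M C ω string = coverString
  where
    open Extension M C ω

    coverString : StringProp cover
    coverString c c′ far with view c | view c′
    ... | ‵inject₁ i | ‵inject₁ j =
      FourCycle-inject₁-inject₁ string i j (FarApart-inject₁ i j far)
    ... | ‵inject₁ i | ‵fromℕ =
      FourCycle-inject₁-fromℕ i (FarApart-fromℕ i far)
    ... | ‵fromℕ | ‵inject₁ j =
      FourCycle-fromℕ-inject₁ j (FarApart-fromℕ j (FarApart-sym (fromℕ n) (inject₁ j) far))
    ... | ‵fromℕ | ‵fromℕ = ⊥-elim (FarApart-irrefl (fromℕ n) far)
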